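{- Let $\Gamma_1,\Gamma_2$ be channel environments such that for every channel $c$, $c$ is exposed in $\Gamma_1$ if and only if $c$ is exposed in $\Gamma_2$. Then for every closed system term $W$ and every action $\lambda\neq\sigma$ (i.e. $\lambda\in\{\tau\}\cup\{c!v,c?v\}$), $\Gamma_1\triangleright W\xrightarrow{\lambda}W'$ implies $\Gamma_2\triangleright W\xrightarrow{\lambda}W'$.
   Context: The calculus CCCP. Fix a set of channels ranged over by $c,d$, and a set of values containing data variables $x,y$ and a distinguished error value $\mathtt{err}$; every closed value $v$ has a transmission time $\delta_v$, a positive integer. Expressions $e$ are built from values, with an evaluation map $[\![\cdot]\!]$ sending variable-free expressions to closed values; Boolean expressions $b$ are $e_1=e_2$ or $\mathrm{exp}(c)$. Processes: $P,Q ::= c!\langle e\rangle.P \mid \lfloor c?(x).P\rfloor Q \mid \sigma.P \mid \tau.P \mid P+Q \mid [b]P,Q \mid X \mid \mathbf{nil} \mid \mathrm{fix}\,X.P$. System terms: $W ::= P \mid \lceil c?(x).P\rceil \mid W_1\,|\,W_2 \mid \nu c{:}(n,v).W$ ($n\in\mathbb N$, $v$ closed). $x$ is bound in $P$ in both input forms, $X$ in $\mathrm{fix}\,X.P$, $c$ in $\nu c{:}(n,v).W$; terms are up to $\alpha$-conversion. In $\mathrm{fix}\,X.P$ every occurrence of $X$ in $P$ is guarded (inside a broadcast prefix, body or timeout branch of an input, a $\sigma$-prefix, or a matching branch). $\sigma^n.P$ denotes $n$ nested $\sigma$-prefixes. A channel environment $\Gamma$ maps channels to $\mathbb N\times\{\text{closed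 values}\}$; $\Gamma\vdash_t c:n$, $\Gamma\vdash_v c:w$ mean $\Gamma(c)=(n,w)$; $c$ is idle if $n=0$, exposed otherwise; $\Gamma[c\mapsto(n,v)]$ is the update at $c$. $c!v(\Gamma)$ agrees with $\Gamma$ except at $c$, where it is $(\delta_v,v)$ if $c$ idle in $\Gamma$ and $(\max(\delta_v,t_c),\mathtt{err})$ if exposed with $\Gamma\vdash_t c:t_c$. $[\![e_1=e_2]\!]_\Gamma$ true iff $[\![e_1]\!]=[\![e_2]\!]$; $[\![\mathrm{exp}(c)]\!]_\Gamma$ true iff $c$ exposed in $\Gamma$. $\mathrm{rcv}(W,c)$: true for $\lfloor c?(x).P\rfloor Q$; disjunctive over $+$ and $|$; $\mathrm{rcv}(\mathrm{fix}\,X.P,c)=\mathrm{rcv}(P,c)$; $\mathrm{rcv}(\nu d{:}(n,v).W,c)=\mathrm{rcv}(W,c)$ for $d\ne c$; false otherwise. $\mathrm{rcv}(\Gamma\triangleright W,c)$ iff $c$ idle in $\Gamma$ and $\mathrm{rcv}(W,c)$. A configuration $\Gamma\triangleright W$ has $W$ closed. Intensional transitions $\Gamma\triangleright W\xrightarrow{\lambda}W'$, $\lambda\in\{c!v,c?v,\sigma,\tau\}$, form the least relation closed under: (Snd) $[\![e]\!]=v$ gives $\Gamma\triangleright c!\langle e\rangle.P\xrightarrow{c!v}\sigma^{\delta_v}.P$; (Rcv) $c$ idle gives $\Gamma\triangleright\lfloor c?(x).P\rfloor Q\xrightarrow{c?v}\lceil c?(x).P\rceil$; (RcvIgn) not $\mathrm{rcv}(\Gamma\triangleright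 W,c)$ gives $\Gamma\triangleright W\xrightarrow{c?v}W$; (Sync) $W_1\xrightarrow{c!v}W_1'$, $W_2\xrightarrow{c?v}W_2'$ (under $\Gamma$) give $W_1|W_2\xrightarrow{c!v}W_1'|W_2'$, and symmetrically; (RcvPar) $W_i\xrightarrow{c?v}W_i'$ give $W_1|W_2\xrightarrow{c?v}W_1'|W_2'$; (TimeNil) $\mathbf{nil}\xrightarrow{\sigma}\mathbf{nil}$; (Sleep) $\sigma.P\xrightarrow{\sigma}P$; (ActRcv) $\Gamma\vdash_t c:n>1$ gives $\lceil c?(x).P\rceil\xrightarrow{\sigma}\lceil c?(x).P\rceil$; (EndRcv) $\Gamma\vdash_t c:1$, $\Gamma\vdash_v c:w$ give $\lceil c?(x).P\rceil\xrightarrow{\sigma}\{w/x\}P$; (Timeout) $c$ idle gives $\lfloor c?(x).P\rfloor Q\xrightarrow{\sigma}Q$; (RcvLate) $c$ exposed gives $\lfloor c?(x).P\rfloor Q\xrightarrow{\tau}\lceil c?(x).\{\mathtt{err}/x\}P\rceil$; (Tau) $\tau.P\xrightarrow{\tau}P$; (Then)/(Else) $[b]P,Q\xrightarrow{\tau}\sigma.P$ if $[\![b]\!]_\Gamma$ true, $\xrightarrow{\tau}\sigma.Q$ if false; (TimePar) $W_i\xrightarrow{\sigma}W_i'$ give $W_1|W_2\xrightarrow{\sigma}W_1'|W_2'$; (TauPar) $W_1\xrightarrow{\tau}W_1'$ gives $W_1|W_2\xrightarrow{\tau}W_1'|W_2$, and symmetrically; (Rec) $\{\mathrm{fix}\,X.P/X\}P\xrightarrow{\lambda}W$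 gives $\mathrm{fix}\,X.P\xrightarrow{\lambda}W$; (Sum) $P\xrightarrow{\lambda}W$, $\lambda\in\{\tau,c!v\}$ gives $P+Q\xrightarrow{\lambda}W$, and symmetrically; (SumTime) $P\xrightarrow{\sigma}P'$, $Q\xrightarrow{\sigma}Q'$ give $P+Q\xrightarrow{\sigma}P'+Q'$; (SumRcv) $P\xrightarrow{c?v}W$ and $\mathrm{rcv}(\Gamma\triangleright P,c)$ give $P+Q\xrightarrow{c?v}W$, and symmetrically; (ResI) $\Gamma[c\mapsto(n,v)]\triangleright W\xrightarrow{c!w}W'$ gives $\Gamma\triangleright\nu c{:}(n,v).W\xrightarrow{\tau}\nu c{:}(c!w(\Gamma[c\mapsto(n,v)])(c)).W'$; (ResV) $\Gamma[c\mapsto(n,v)]\triangleright W\xrightarrow{\lambda}W'$ with $c$ not in $\lambda$ gives $\Gamma\triangleright\nu c{:}(n,v).W\xrightarrow{\lambda}\nu c{:}(n,v).W'$. -}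

module Defs where

open import Data.Nat using (ℕ; zero; suc; _≤_; _<_; _⊔_; _≟_)
open import Data.Product using (_×_; _,_; proj₁; proj₂)
open import Data.Sum using (_⊎_)
open import Data.Empty using (⊥)
open import Data.Unit using (⊤)
open import Data.List using (List; []; _∷_)
open import Data.List.Membership.Propositional using (_∈_)
open import Data.List.Relation.Unary.All using (All)
open import Data.Maybe using (Maybe; just)
open import Relation.Nullary using (¬_; yes; no)
open import Relation.Binary.PropositionalEquality using (_≡_; _≢_)

Var : Set
Var = ℕ

PVar : Set
PVar = ℕ

Chan : Set
Chan = ℕ

record ValueSig : Set₁ where
  field
    Val    : Set
    err    : Val
    δ      : Val → ℕ                -- transmission time
    δ-pos  : ∀ v → 1 ≤ δ v
    Expr   : Set
    fvE    : Expr → List Var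
    substE : Var → Val → Expr → Expr
    eval   : Expr → Maybe Val       -- [[e]] (defined, i.e. just, on variable-free expressions)

module CCCP (S : ValueSig) where
  open ValueSig S public

  data BExp : Set where
    _==_ : Expr → Expr → BExp
    exp  : Chan → BExp

  data Proc : Set where
    snd   : Chan → Expr → Proc → Proc
    inp   : Chan → Var → Proc → Proc → Proc      -- ⌊c?(x).P⌋Q
    sleep : Proc → Proc
    tau   : Proc → Proc
    _⊕_   : Proc → Proc → Proc
    cond  : BExp → Proc → Proc → Proc
    pvar  : PVar → Proc
    nil   : Proc
    fix   : PVar → Proc → Proc

  data Sys : Set where
    proc : Proc → Sys
    act  : Chan → Var → Proc → Sys               -- ⌈c?(x).P⌉
    _∥_  : Sys → Sys → Sys
    nu   : Chan → ℕ → Val → Sys → Sys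

  σ^ : ℕ → Proc → Proc
  σ^ zero    P = P
  σ^ (suc n) P = sleep (σ^ n P)

  Unguarded : PVar → Proc → Set
  Unguarded X (snd c e P)    = ⊥
  Unguarded X (inp c x P Q)  = ⊥
  Unguarded X (sleep P)      = ⊥
  Unguarded X (tau P)        = Unguarded X P
  Unguarded X (P ⊕ Q)        = Unguarded X P ⊎ Unguarded X Q
  Unguarded X (cond b P Q)   = ⊥
  Unguarded X (pvar Y)       = X ≡ Y
  Unguarded X nil            = ⊥
  Unguarded X (fix Y P)      = X ≢ Y × Unguarded X P

  GuardedP : Proc → Set
  GuardedP (snd c e P)   = GuardedP P
  GuardedP (inp c x P Q) = GuardedP P × GuardedP Q
  GuardedP (sleep P)     = GuardedP P
  GuardedP (tau P)       = GuardedP P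
  GuardedP (P ⊕ Q)       = GuardedP P × GuardedP Q
  GuardedP (cond b P Q)  = GuardedP P × GuardedP Q
  GuardedP (pvar X)      = ⊤
  GuardedP nil           = ⊤
  GuardedP (fix X P)     = ¬ Unguarded X P × GuardedP P

  GuardedS : Sys → Set
  GuardedS (proc P)     = GuardedP P
  GuardedS (act c x P)  = GuardedP P
  GuardedS (W₁ ∥ W₂)    = GuardedS W₁ × GuardedS W₂
  GuardedS (nu c n v W) = GuardedS W

  ScopedE : List Var → Expr → Set
  ScopedE xs e = All (_∈ xs) (fvE e)

  ScopedB : List Var → BExp → Set
  ScopedB xs (e₁ == e₂) = ScopedE xs e₁ × ScopedE xs e₂
  ScopedB xs (exp c)    = ⊤

  ScopedP : List Var → List PVar → Proc → Set
  ScopedP xs Xs (snd c e P)   = ScopedE xs e × ScopedP xs Xs P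
  ScopedP xs Xs (inp c x P Q) = ScopedP (x ∷ xs) Xs P × ScopedP xs Xs Q
  ScopedP xs Xs (sleep P)     = ScopedP xs Xs P
  ScopedP xs Xs (tau P)       = ScopedP xs Xs P
  ScopedP xs Xs (P ⊕ Q)       = ScopedP xs Xs P × ScopedP xs Xs Q
  ScopedP xs Xs (cond b P Q)  = ScopedB xs b × ScopedP xs Xs P × ScopedP xs Xs Q
  ScopedP xs Xs (pvar X)      = X ∈ Xs
  ScopedP xs Xs nil           = ⊤
  ScopedP xs Xs (fix X P)     = ScopedP xs (X ∷ Xs) P

  ClosedS : Sys → Set
  ClosedS (proc P)     = ScopedP [] [] P
  ClosedS (act c x P)  = ScopedP (x ∷ []) [] P
  ClosedS (W₁ ∥ W₂)    = ClosedS W₁ × ClosedS W₂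
  ClosedS (nu c n v W) = ClosedS W

  -- Substitution (substituends are always closed, so no capture arises)

  substV : Var → Val → Proc → Proc
  substB : Var → Val → BExp → BExp
  substB x w (e₁ == e₂) = substE x w e₁ == substE x w e₂
  substB x w (exp c)    = exp c
  substV x w (snd c e P)   = snd c (substE x w e) (substV x w P)
  substV x w (inp c y P Q) with x ≟ y
  ... | yes _ = inp c y P (substV x w Q)
  ... | no  _ = inp c y (substV x w P) (substV x w Q)
  substV x w (sleep P)     = sleep (substV x w P)
  substV x w (tau P)       = tau (substV x w P)
  substV x w (P ⊕ Q)       = substV x w P ⊕ substV x w Q
  substV x w (cond b P Q)  = cond (substB x w b) (substV x w P) (substV x w Q)
  substV x w (pvar X)      = pvar X
  substV x w nil           = nil
  substV x w (fix X P)     = fix X (substV x w P)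

  substX : PVar → Proc → Proc → Proc
  substX X R (snd c e P)   = snd c e (substX X R P)
  substX X R (inp c y P Q) = inp c y (substX X R P) (substX X R Q)
  substX X R (sleep P)     = sleep (substX X R P)
  substX X R (tau P)       = tau (substX X R P)
  substX X R (P ⊕ Q)       = substX X R P ⊕ substX X R Q
  substX X R (cond b P Q)  = cond b (substX X R P) (substX X R Q)
  substX X R (pvar Y) with X ≟ Y
  ... | yes _ = R
  ... | no  _ = pvar Y
  substX X R nil           = nil
  substX X R (fix Y P) with X ≟ Y
  ... | yes _ = fix Y P
  ... | no  _ = fix Y (substX X R P)

  Env : Set
  Env = Chan → ℕ × Val

  Idle : Env → Chan → Set
  Idle Γ c = proj₁ (Γ c) ≡ 0

  Exposed : Env → Chan → Set
  Exposed Γ c = ¬ (proj₁ (Γ c) ≡ 0)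

  _[_↦_] : Env → Chan → ℕ × Val → Env
  (Γ [ c ↦ p ]) d with d ≟ c
  ... | yes _ = p
  ... | no  _ = Γ d

  bcastEntry : ℕ × Val → Val → ℕ × Val
  bcastEntry (zero  , w) v = (δ v , v)
  bcastEntry (suc t , w) v = (δ v ⊔ suc t , err)

  bcast : Chan → Val → Env → Env
  bcast c v Γ = Γ [ c ↦ bcastEntry (Γ c) v ]

  ⟦_⟧_ : BExp → Env → Set
  ⟦ e₁ == e₂ ⟧ Γ = eval e₁ ≡ eval e₂
  ⟦ exp c ⟧ Γ    = Exposed Γ c

  rcvP : Proc → Chan → Set
  rcvP (inp d x P Q) c = d ≡ c
  rcvP (P ⊕ Q)       c = rcvP P c ⊎ rcvP Q c
  rcvP (fix X P)     c = rcvP P c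
  rcvP _             c = ⊥

  rcvS : Sys → Chan → Set
  rcvS (proc P)     c = rcvP P c
  rcvS (act d x P)  c = ⊥
  rcvS (W₁ ∥ W₂)    c = rcvS W₁ c ⊎ rcvS W₂ c
  rcvS (nu d n v W) c = d ≢ c × rcvS W c

  rcv : Env → Sys → Chan → Set
  rcv Γ W c = Idle Γ c × rcvS W c

  data Action : Set where
    out : Chan → Val → Action
    in? : Chan → Val → Action
    σ   : Action
    τ   : Action

  _∉Act_ : Chan → Action → Set
  c ∉Act out d v = c ≢ d
  c ∉Act in? d v = c ≢ d
  c ∉Act σ       = ⊤
  c ∉Act τ       = ⊤

  infix 3 _⊢_─[_]→_

  data _⊢_─[_]→_ (Γ : Env) : Sys → Action → Sys → Set where
    Snd     : ∀ {c e P v} → eval e ≡ just v →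
              Γ ⊢ proc (snd c e P) ─[ out c v ]→ proc (σ^ (δ v) P)
    Rcv     : ∀ {c x P Q v} → Idle Γ c →
              Γ ⊢ proc (inp c x P Q) ─[ in? c v ]→ act c x P
    RcvIgn  : ∀ {W c v} → ¬ rcv Γ W c →
              Γ ⊢ W ─[ in? c v ]→ W
    SyncL   : ∀ {W₁ W₂ W₁' W₂' c v} →
              Γ ⊢ W₁ ─[ out c v ]→ W₁' → Γ ⊢ W₂ ─[ in? c v ]→ W₂' →
              Γ ⊢ W₁ ∥ W₂ ─[ out c v ]→ W₁' ∥ W₂'
    SyncR   : ∀ {W₁ W₂ W₁' W₂' c v} →
              Γ ⊢ W₁ ─[ in? c v ]→ W₁' → Γ ⊢ W₂ ─[ out c v ]→ W₂' →
              Γ ⊢ W₁ ∥ W₂ ─[ out c v ]→ W₁' ∥ W₂'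
    RcvPar  : ∀ {W₁ W₂ W₁' W₂' c v} →
              Γ ⊢ W₁ ─[ in? c v ]→ W₁' → Γ ⊢ W₂ ─[ in? c v ]→ W₂' →
              Γ ⊢ W₁ ∥ W₂ ─[ in? c v ]→ W₁' ∥ W₂'
    TimeNil : Γ ⊢ proc nil ─[ σ ]→ proc nil
    Sleep   : ∀ {P} → Γ ⊢ proc (sleep P) ─[ σ ]→ proc P
    ActRcv  : ∀ {c x P} → 1 < proj₁ (Γ c) →
              Γ ⊢ act c x P ─[ σ ]→ act c x P
    EndRcv  : ∀ {c x P} → proj₁ (Γ c) ≡ 1 →
              Γ ⊢ act c x P ─[ σ ]→ proc (substV x (proj₂ (Γ c)) P)
    Timeout : ∀ {c x P Q} → Idle Γ c →
              Γ ⊢ proc (inp c x P Q) ─[ σ ]→ proc Q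
    RcvLate : ∀ {c x P Q} → Exposed Γ c →
              Γ ⊢ proc (inp c x P Q) ─[ τ ]→ act c x (substV x err P)
    Tau     : ∀ {P} → Γ ⊢ proc (tau P) ─[ τ ]→ proc P
    Then    : ∀ {b P Q} → ⟦ b ⟧ Γ →
              Γ ⊢ proc (cond b P Q) ─[ τ ]→ proc (sleep P)
    Else    : ∀ {b P Q} → ¬ (⟦ b ⟧ Γ) →
              Γ ⊢ proc (cond b P Q) ─[ τ ]→ proc (sleep Q)
    TimePar : ∀ {W₁ W₂ W₁' W₂'} →
              Γ ⊢ W₁ ─[ σ ]→ W₁' → Γ ⊢ W₂ ─[ σ ]→ W₂' →
              Γ ⊢ W₁ ∥ W₂ ─[ σ ]→ W₁' ∥ W₂'
    TauParL : ∀ {W₁ W₂ W₁'} → Γ ⊢ W₁ ─[ τ ]→ W₁' →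
              Γ ⊢ W₁ ∥ W₂ ─[ τ ]→ W₁' ∥ W₂
    TauParR : ∀ {W₁ W₂ W₂'} → Γ ⊢ W₂ ─[ τ ]→ W₂' →
              Γ ⊢ W₁ ∥ W₂ ─[ τ ]→ W₁ ∥ W₂'
    Rec     : ∀ {X P λ' W} → Γ ⊢ proc (substX X (fix X P) P) ─[ λ' ]→ W →
              Γ ⊢ proc (fix X P) ─[ λ' ]→ W
    SumTauL : ∀ {P Q W} → Γ ⊢ proc P ─[ τ ]→ W → Γ ⊢ proc (P ⊕ Q) ─[ τ ]→ W
    SumTauR : ∀ {P Q W} → Γ ⊢ proc Q ─[ τ ]→ W → Γ ⊢ proc (P ⊕ Q) ─[ τ ]→ W
    SumOutL : ∀ {P Q W c v} → Γ ⊢ proc P ─[ out c v ]→ W →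
              Γ ⊢ proc (P ⊕ Q) ─[ out c v ]→ W
    SumOutR : ∀ {P Q W c v} → Γ ⊢ proc Q ─[ out c v ]→ W →
              Γ ⊢ proc (P ⊕ Q) ─[ out c v ]→ W
    SumTime : ∀ {P Q P' Q'} → Γ ⊢ proc P ─[ σ ]→ proc P' → Γ ⊢ proc Q ─[ σ ]→ proc Q' →
              Γ ⊢ proc (P ⊕ Q) ─[ σ ]→ proc (P' ⊕ Q')
    SumRcvL : ∀ {P Q W c v} → Γ ⊢ proc P ─[ in? c v ]→ W → rcv Γ (proc P) c →
              Γ ⊢ proc (P ⊕ Q) ─[ in? c v ]→ W
    SumRcvR : ∀ {P Q W c v} → Γ ⊢ proc Q ─[ in? c v ]→ W → rcv Γ (proc Q) c →
              Γ ⊢ proc (P ⊕ Q) ─[ in? c v ]→ W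
    ResI    : ∀ {c n v W W' w} → (Γ [ c ↦ (n , v) ]) ⊢ W ─[ out c w ]→ W' →
              Γ ⊢ nu c n v W ─[ τ ]→
                  nu c (proj₁ (bcast c w (Γ [ c ↦ (n , v) ]) c))
                       (proj₂ (bcast c w (Γ [ c ↦ (n , v) ]) c)) W'
    ResV    : ∀ {c n v W W' λ'} → c ∉Act λ' → (Γ [ c ↦ (n , v) ]) ⊢ W ─[ λ' ]→ W' →
              Γ ⊢ nu c n v W ─[ λ' ]→ nu c n v W'

module Submission where

-- Inspecting the rules, Γ is consulted by a non-σ transition only via:
-- idleness of a channel (Rcv, RcvIgn, SumRcv), exposure of a channel
-- (RcvLate, and the guard exp(c) in Then/Else), and, under a restriction
-- ν c:(n,v), the updated environment Γ[c ↦ (n,v)].  The σ-rules, which also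
-- read the exposure *time* (ActRcv, EndRcv), are excluded by hypothesis.
--
-- So we call two environments exposure-equivalent when they expose the same
-- channels, and show that this relation is symmetric, transfers idleness,
-- rcv and Boolean guards, and is preserved by updating both environments at
-- the same channel.  For ResI we observe that the new entry c!w(Γ[c ↦ p])(c)
-- equals bcastEntry p w, independently of Γ.

open import Defs
open import Data.Nat using (_≟_)
open import Data.Product using (_×_; _,_; proj₁; proj₂; swap)
open import Data.Empty using (⊥-elim)
open import Function using (id)
open import Relation.Nullary using (yes; no)
open import Relation.Nullary.Decidable using (decidable-stable)
open import Relation.Binary.PropositionalEquality using (_≡_; _≢_; refl; subst)

module ExposureInvariance (S : ValueSig) where
  open CCCP S

  -- Γ₁ and Γ₂ expose exactly the same channels.  A record rather than a
  -- type synonym, so that Γ₁ and Γ₂ are inferable from a proof of it.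
  record ExposureEquiv (Γ₁ Γ₂ : Env) : Set where
    constructor sameExposure
    field exposed⇔ : ∀ c → (Exposed Γ₁ c → Exposed Γ₂ c) × (Exposed Γ₂ c → Exposed Γ₁ c)
  open ExposureEquiv

  exposed→ : ∀ {Γ₁ Γ₂} → ExposureEquiv Γ₁ Γ₂ → ∀ c → Exposed Γ₁ c → Exposed Γ₂ c
  exposed→ h c = proj₁ (exposed⇔ h c)

  -- The relation is symmetric, giving the backward direction of every
  -- transfer lemma (used for the negative premises of RcvIgn and Else).
  ≈-sym : ∀ {Γ₁ Γ₂} → ExposureEquiv Γ₁ Γ₂ → ExposureEquiv Γ₂ Γ₁
  ≈-sym h = sameExposure (λ c → swap (exposed⇔ h c))

  -- Idleness is the negation of exposure on a decidable property of ℕ,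
  -- so it is transferred by the backward implication.
  idle-transfer : ∀ {Γ₁ Γ₂} → ExposureEquiv Γ₁ Γ₂ →
                  ∀ c → Idle Γ₁ c → Idle Γ₂ c
  idle-transfer {Γ₂ = Γ₂} h c idle₁ =
    decidable-stable (proj₁ (Γ₂ c) ≟ 0) (λ exposed₂ → exposed→ (≈-sym h) c exposed₂ idle₁)

  rcv-transfer : ∀ {Γ₁ Γ₂} → ExposureEquiv Γ₁ Γ₂ →
                 ∀ W c → rcv Γ₁ W c → rcv Γ₂ W c
  rcv-transfer h W c (idle₁ , receives) = idle-transfer h c idle₁ , receives

  guard-transfer : ∀ {Γ₁ Γ₂} → ExposureEquiv Γ₁ Γ₂ →
                   ∀ b → ⟦ b ⟧ Γ₁ → ⟦ b ⟧ Γ₂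
  guard-transfer h (e₁ == e₂) equal   = equal
  guard-transfer h (exp c)    exposed = exposed→ h c exposed

  -- Updating both environments at the same channel with the same entry
  -- preserves equivalence; needed to pass under a restriction ν c:(n,v).
  update-preserves : ∀ {Γ₁ Γ₂} → ExposureEquiv Γ₁ Γ₂ →
                     ∀ c p → ExposureEquiv (Γ₁ [ c ↦ p ]) (Γ₂ [ c ↦ p ])
  update-preserves {Γ₁} {Γ₂} h c p = sameExposure same
    where
    same : ∀ d → (Exposed (Γ₁ [ c ↦ p ]) d → Exposed (Γ₂ [ c ↦ p ]) d)
               × (Exposed (Γ₂ [ c ↦ p ]) d → Exposed (Γ₁ [ c ↦ p ]) d)
    same d with d ≟ c
    ... | yes _ = id , id
    ... | no  _ = exposed⇔ h d

  update-self : ∀ Γ c p → (Γ [ c ↦ p ]) c ≡ p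
  update-self Γ c p with c ≟ c
  ... | yes _  = refl
  ... | no c≢c = ⊥-elim (c≢c refl)

  bcast-updated : ∀ Γ c p w → bcast c w (Γ [ c ↦ p ]) c ≡ bcastEntry p w
  bcast-updated Γ c p w rewrite update-self Γ c p =
    update-self (Γ [ c ↦ p ]) c (bcastEntry p w)

  -- ResI with its target stated in an environment-independent form.
  resI : ∀ {Γ c n v W W' w} → (Γ [ c ↦ (n , v) ]) ⊢ W ─[ out c w ]→ W' →
         Γ ⊢ nu c n v W ─[ τ ]→
             nu c (proj₁ (bcastEntry (n , v) w)) (proj₂ (bcastEntry (n , v) w)) W'
  resI {Γ} {c} {n} {v} {W' = W'} {w} step =
    subst (λ e → Γ ⊢ _ ─[ τ ]→ nu c (proj₁ e) (proj₂ e) W')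
          (bcast-updated Γ c (n , v) w) (ResI step)

  transfer : ∀ {Γ₁ Γ₂} → ExposureEquiv Γ₁ Γ₂ → ∀ {W W' λ'} → λ' ≢ σ →
             Γ₁ ⊢ W ─[ λ' ]→ W' → Γ₂ ⊢ W ─[ λ' ]→ W'
  transfer h ¬σ (Snd ev)                  = Snd ev
  transfer h ¬σ (Rcv {c = c} idle)        = Rcv (idle-transfer h c idle)
  transfer h ¬σ (RcvIgn {W = W} {c = c} ¬rcv) =
    RcvIgn (λ r → ¬rcv (rcv-transfer (≈-sym h) W c r))
  transfer h ¬σ (SyncL s r)               = SyncL (transfer h (λ ()) s) (transfer h (λ ()) r)
  transfer h ¬σ (SyncR r s)               = SyncR (transfer h (λ ()) r) (transfer h (λ ()) s)
  transfer h ¬σ (RcvPar r₁ r₂)            = RcvPar (transfer h ¬σ r₁) (transfer h ¬σ r₂)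
  transfer h ¬σ TimeNil                   = ⊥-elim (¬σ refl)
  transfer h ¬σ Sleep                     = ⊥-elim (¬σ refl)
  transfer h ¬σ (ActRcv _)                = ⊥-elim (¬σ refl)
  transfer h ¬σ (EndRcv _)                = ⊥-elim (¬σ refl)
  transfer h ¬σ (Timeout _)               = ⊥-elim (¬σ refl)
  transfer h ¬σ (TimePar _ _)             = ⊥-elim (¬σ refl)
  transfer h ¬σ (SumTime _ _)             = ⊥-elim (¬σ refl)
  transfer h ¬σ (RcvLate {c = c} exposed) = RcvLate (exposed→ h c exposed)
  transfer h ¬σ Tau                       = Tau
  transfer h ¬σ (Then {b = b} holds)      = Then (guard-transfer h b holds)
  transfer h ¬σ (Else {b = b} fails)      =
    Else (λ holds → fails (guard-transfer (≈-sym h) b holds))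
  transfer h ¬σ (TauParL s)               = TauParL (transfer h ¬σ s)
  transfer h ¬σ (TauParR s)               = TauParR (transfer h ¬σ s)
  transfer h ¬σ (Rec s)                   = Rec (transfer h ¬σ s)
  transfer h ¬σ (SumTauL s)               = SumTauL (transfer h ¬σ s)
  transfer h ¬σ (SumTauR s)               = SumTauR (transfer h ¬σ s)
  transfer h ¬σ (SumOutL s)               = SumOutL (transfer h ¬σ s)
  transfer h ¬σ (SumOutR s)               = SumOutR (transfer h ¬σ s)
  transfer h ¬σ (SumRcvL {P = P} {c = c} s r) =
    SumRcvL (transfer h ¬σ s) (rcv-transfer h (proc P) c r)
  transfer h ¬σ (SumRcvR {Q = Q} {c = c} s r) =
    SumRcvR (transfer h ¬σ s) (rcv-transfer h (proc Q) c r)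
  transfer {Γ₁} h ¬σ (ResI {c = c} {n = n} {v = v} {w = w} s)
    rewrite bcast-updated Γ₁ c (n , v) w =
      resI (transfer (update-preserves h c (n , v)) (λ ()) s)
  transfer h ¬σ (ResV {c = c} {n = n} {v = v} fresh s) =
    ResV fresh (transfer (update-preserves h c (n , v)) ¬σ s)

mainTheorem7 : (S : ValueSig) → let open CCCP S in
    (Γ₁ Γ₂ : Env) →
    (∀ c → (Exposed Γ₁ c → Exposed Γ₂ c) × (Exposed Γ₂ c → Exposed Γ₁ c)) →
    (W W' : Sys) → ClosedS W → GuardedS W →
    (λ' : Action) → λ' ≢ σ →
    Γ₁ ⊢ W ─[ λ' ]→ W' → Γ₂ ⊢ W ─[ λ' ]→ W'
mainTheorem7 S Γ₁ Γ₂ exposedIff W W' _ _ λ' ¬σ step =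
  transfer (sameExposure exposedIff) ¬σ step
  where open ExposureInvariance S
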